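{- Let $k \geq 2$ be an integer, $d \in (0,1)$, and $\zeta = (d/4)^k$. Let $H$ be a bipartite graph with parts $A,B$, where $|B| \geq 2k/d$, and suppose $H$ has at least $d|A||B|$ edges. Let $\mathcal{H}$ be a $k$-uniform hypergraph with vertex set $B$ and at least $(1-\zeta)\binom{|B|}{k}$ edges. Then there are at least $\zeta\binom{|B|}{k}$ edges of $\mathcal{H}$ such that the $k$ vertices of each such edge have at least $\zeta|A|$ common neighbors in $A$ (in $H$).
   Formalization: The parameter d ranges only over rational numbers in the interval (0,1). -}

module Defs where

open import Data.Bool using (Bool; true; false; _∧_; _∨_; not)
open import Data.Nat using (ℕ; zero; suc)
open import Data.Integer using (+_)
open import Data.Rational using (ℚ; _/_; _*_; 1ℚ)
open import Data.Fin using (Fin)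
open import Data.Fin.Subset using (Subset; ∣_∣)
open import Data.Vec using (Vec; []; _∷_; lookup)
open import Data.List using (List; []; _∷_; map; _++_; length; filterᵇ; allFin; cartesianProduct)
open import Data.Product using (_,_)
open import Relation.Binary.PropositionalEquality using (_≡_)

ℕ→ℚ : ℕ → ℚ
ℕ→ℚ n = + n / 1

_^ℚ_ : ℚ → ℕ → ℚ
p ^ℚ zero = 1ℚ
p ^ℚ suc n = p * (p ^ℚ n)

count : {X : Set} → (X → Bool) → List X → ℕ
count p xs = length (filterᵇ p xs)

allSubsets : (n : ℕ) → List (Subset n)
allSubsets zero = [] ∷ []
allSubsets (suc n) = map (true ∷_) (allSubsets n) ++ map (false ∷_) (allSubsets n)

-- bipartite graph with parts A = Fin a, B = Fin b, given by its adjacency relation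
BipGraph : ℕ → ℕ → Set
BipGraph a b = Fin a → Fin b → Bool

eBip : {a b : ℕ} → BipGraph a b → ℕ
eBip {a} {b} H = count (λ { (x , y) → H x y }) (cartesianProduct (allFin a) (allFin b))

-- hypergraph on vertex set Fin b: its edge set, a set of subsets of Fin b
Hypergraph : ℕ → Set
Hypergraph b = Subset b → Bool

Uniform : {b : ℕ} → ℕ → Hypergraph b → Set
Uniform k ℋ = ∀ S → ℋ S ≡ true → ∣ S ∣ ≡ k

eHyp : {b : ℕ} → Hypergraph b → ℕ
eHyp {b} ℋ = count ℋ (allSubsets b)

allᵇ : {X : Set} → (X → Bool) → List X → Bool
allᵇ p [] = true
allᵇ p (x ∷ xs) = p x ∧ allᵇ p xs

commonNbrs : {a b : ℕ} → BipGraph a b → Subset b → ℕ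
commonNbrs {a} {b} H S =
  count (λ x → allᵇ (λ y → not (lookup S y) ∨ H x y) (allFin b)) (allFin a)

goodEdges : {a b : ℕ} → BipGraph a b → Hypergraph b → ℚ → ℕ
goodEdges {a} {b} H ℋ t =
  count (λ S → ℋ S ∧ (t Data.Rational.≤ᵇ ℕ→ℚ (commonNbrs H S))) (allSubsets b)

{-# OPTIONS --safe #-}

-- Let m = ⌊e(H)/|A|⌋. Counting pairs (x, S) with S a k-subset of the neighbourhood of x gives
-- Σ_S |N(S)| = Σ_x C(deg x, k) ≥ |A| C(m, k), by convexity of n ↦ C(n, k). Since
-- (d/2)|B| + k ≤ d|B| < m + 1, every ratio (m − j)/(|B| − j) with j < k is at least d/2, so
-- C(m, k) ≥ (d/2)^k C(|B|, k) ≥ 4ζ C(|B|, k). As |N(S)| ≤ |A|, the k-sets with fewer than ζ|A|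
-- common neighbours contribute at most ζ|A| C(|B|, k) to that sum, hence at least 3ζ C(|B|, k)
-- k-sets have at least ζ|A| common neighbours, while at most ζ C(|B|, k) k-sets are not edges of ℋ.

module Submission where

open import Defs
open import Data.Bool using (Bool; true; false; _∧_; _∨_; not; T)
import Data.Bool.Properties as Boolₚ
open import Data.Fin using (Fin) renaming (zero to fzero; suc to fsuc)
open import Data.Fin.Subset using (Subset; ∣_∣)
open import Data.List using (List; []; _∷_; _++_; map; length; allFin; cartesianProduct)
import Data.List.Properties as Listₚ
open import Data.Nat as ℕ using (ℕ; zero; suc; _+_; _*_; _∸_; _≤_; _≡ᵇ_; z≤n; s≤s; _≤′_; ≤′-refl; ≤′-step)
import Data.Nat.Properties as ℕₚ
open import Algebra.Properties.CommutativeSemigroup ℕₚ.+-commutativeSemigroup using (interchange; x∙yz≈y∙xz)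
open import Data.Nat.Combinatorics using (_C_; nCk+nC[k+1]≡[n+1]C[k+1]; nC1≡n; k>n⇒nCk≡0)
import Data.Nat.Coprimality as Coprime
open import Data.Nat.DivMod using (_/_; m/n*n≤m; m≡m%n+[m/n]*n; m%n<n)
open import Data.Nat.Tactic.RingSolver using (solve-∀)
import Data.Integer as ℤ
import Data.Integer.Properties as ℤₚ
open import Data.Rational using (ℚ; mkℚ; 0ℚ; 1ℚ; _<_; _-_; _÷_; _≤ᵇ_; nonNegative; positive; *≤*; *<*)
  renaming (_≤_ to _≤ℚ_; _*_ to _*ℚ_; _+_ to _+ℚ_)
import Data.Rational as ℚ
import Data.Rational.Properties as ℚₚ
open import Data.Rational.Solver using (module +-*-Solver)
open import Data.Product using (_,_)
open import Data.Sum using ([_,_]′)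
open import Data.Vec using (_∷_; lookup)
open import Function using (id; _∘_; _$_)
open import Function.Bundles using (Equivalence)
open import Relation.Binary.PropositionalEquality
open import Relation.Nullary.Decidable using (T?)

private
  variable
    X Y : Set
    p q r s : ℚ

-- Finite sums

∑ : {X : Set} → List X → (X → ℕ) → ℕ
∑ []       f = 0
∑ (x ∷ xs) f = f x + ∑ xs f

infix 9 ∑
syntax ∑ xs (λ x → e) = ∑[ x ∈ xs ] e

ind : Bool → ℕ
ind true  = 1
ind false = 0

ind-∧ : ∀ β γ → ind (β ∧ γ) ≡ ind β * ind γ
ind-∧ true  γ = sym (ℕₚ.+-identityʳ (ind γ))
ind-∧ false γ = refl

∑-cong : ∀ xs {f g : X → ℕ} → (∀ x → f x ≡ g x) → ∑ xs f ≡ ∑ xs g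
∑-cong []       f≡g = refl
∑-cong (x ∷ xs) f≡g = cong₂ _+_ (f≡g x) (∑-cong xs f≡g)

∑-mono-≤ : ∀ xs {f g : X → ℕ} → (∀ x → f x ≤ g x) → ∑ xs f ≤ ∑ xs g
∑-mono-≤ []       f≤g = z≤n
∑-mono-≤ (x ∷ xs) f≤g = ℕₚ.+-mono-≤ (f≤g x) (∑-mono-≤ xs f≤g)

∑-++ : ∀ xs ys (f : X → ℕ) → ∑ (xs ++ ys) f ≡ ∑ xs f + ∑ ys f
∑-++ []       ys f = refl
∑-++ (x ∷ xs) ys f = trans (cong (f x +_) (∑-++ xs ys f)) (sym (ℕₚ.+-assoc (f x) _ _))

∑-map : ∀ (g : Y → X) ys (f : X → ℕ) → ∑ (map g ys) f ≡ ∑[ y ∈ ys ] f (g y)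
∑-map g []       f = refl
∑-map g (y ∷ ys) f = cong (f (g y) +_) (∑-map g ys f)

∑-+ : ∀ xs (f g : X → ℕ) → ∑[ x ∈ xs ] (f x + g x) ≡ ∑ xs f + ∑ xs g
∑-+ []       f g = refl
∑-+ (x ∷ xs) f g = trans (cong (f x + g x +_) (∑-+ xs f g)) (interchange (f x) (g x) _ _)

∑-*ˡ : ∀ c xs (f : X → ℕ) → ∑[ x ∈ xs ] (c * f x) ≡ c * ∑ xs f
∑-*ˡ c []       f = sym (ℕₚ.*-zeroʳ c)
∑-*ˡ c (x ∷ xs) f = trans (cong (c * f x +_) (∑-*ˡ c xs f)) (sym (ℕₚ.*-distribˡ-+ c (f x) _))

∑-*ʳ : ∀ c xs (f : X → ℕ) → ∑[ x ∈ xs ] (f x * c) ≡ ∑ xs f * c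
∑-*ʳ c xs f = begin
  ∑[ x ∈ xs ] (f x * c)  ≡⟨ ∑-cong xs (λ x → ℕₚ.*-comm (f x) c) ⟩
  ∑[ x ∈ xs ] (c * f x)  ≡⟨ ∑-*ˡ c xs f ⟩
  c * ∑ xs f             ≡⟨ ℕₚ.*-comm c _ ⟩
  ∑ xs f * c             ∎
  where open ≡-Reasoning

∑-const : ∀ (xs : List X) c → ∑[ x ∈ xs ] c ≡ length xs * c
∑-const []       c = refl
∑-const (x ∷ xs) c = cong (c +_) (∑-const xs c)

∑-zero : ∀ (xs : List X) → ∑[ x ∈ xs ] 0 ≡ 0
∑-zero xs = trans (∑-const xs 0) (ℕₚ.*-zeroʳ (length xs))

∑-swap : ∀ xs (ys : List Y) (f : X → Y → ℕ) →
         ∑[ x ∈ xs ] ∑[ y ∈ ys ] f x y ≡ ∑[ y ∈ ys ] ∑[ x ∈ xs ] f x y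
∑-swap []       ys f = sym (∑-zero ys)
∑-swap (x ∷ xs) ys f = trans (cong (∑ ys (f x) +_) (∑-swap xs ys f))
                             (sym (∑-+ ys (f x) (λ y → ∑[ x ∈ xs ] f x y)))

∑-cartesianProduct : ∀ (xs : List X) (ys : List Y) f →
  ∑ (cartesianProduct xs ys) f ≡ ∑[ x ∈ xs ] ∑[ y ∈ ys ] f (x , y)
∑-cartesianProduct []       ys f = refl
∑-cartesianProduct (x ∷ xs) ys f = begin
  ∑ (map (x ,_) ys ++ cartesianProduct xs ys) f
    ≡⟨ ∑-++ (map (x ,_) ys) _ f ⟩
  ∑ (map (x ,_) ys) f + ∑ (cartesianProduct xs ys) f
    ≡⟨ cong₂ _+_ (∑-map (x ,_) ys f) (∑-cartesianProduct xs ys f) ⟩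
  ∑[ y ∈ ys ] f (x , y) + ∑[ x ∈ xs ] ∑[ y ∈ ys ] f (x , y) ∎
  where open ≡-Reasoning

count≡∑ind : ∀ (p : X → Bool) xs → count p xs ≡ ∑[ x ∈ xs ] ind (p x)
count≡∑ind p []       = refl
count≡∑ind p (x ∷ xs) with p x
... | true  = cong suc (count≡∑ind p xs)
... | false = count≡∑ind p xs

allᵇ-map : ∀ (p : X → Bool) (g : Y → X) ys → allᵇ p (map g ys) ≡ allᵇ (p ∘ g) ys
allᵇ-map p g []       = refl
allᵇ-map p g (y ∷ ys) = cong (p (g y) ∧_) (allᵇ-map p g ys)

allᵇ-true : ∀ (p : X → Bool) xs → (∀ x → p x ≡ true) → allᵇ p xs ≡ true
allᵇ-true p []       p≡true = refl
allᵇ-true p (x ∷ xs) p≡true rewrite p≡true x = allᵇ-true p xs p≡true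

length-allFin : ∀ n → length (allFin n) ≡ n
length-allFin n = Listₚ.length-tabulate id

allFin-suc : ∀ n → allFin (suc n) ≡ fzero ∷ map fsuc (allFin n)
allFin-suc n = cong (fzero ∷_) (sym (Listₚ.map-tabulate id fsuc))

∑-allFin-suc : ∀ n (f : Fin (suc n) → ℕ) → ∑ (allFin (suc n)) f ≡ f fzero + ∑[ i ∈ allFin n ] f (fsuc i)
∑-allFin-suc n f = trans (cong (λ is → ∑ is f) (allFin-suc n)) (cong (f fzero +_) (∑-map fsuc (allFin n) f))

-- Subsets of a given size

-- Chosen so that commonNbrs H S is definitionally count (λ x → S ⊆ᵇ H x) (allFin a).
_⊆ᵇ_ : {b : ℕ} → Subset b → (Fin b → Bool) → Bool
S ⊆ᵇ g = allᵇ (λ y → not (lookup S y) ∨ g y) (allFin _)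

∷-⊆ᵇ : ∀ {b} x (S : Subset b) g → (x ∷ S) ⊆ᵇ g ≡ (not x ∨ g fzero) ∧ S ⊆ᵇ (g ∘ fsuc)
∷-⊆ᵇ {b} x S g = begin
  allᵇ P (allFin (suc b))                     ≡⟨ cong (allᵇ P) (allFin-suc b) ⟩
  P fzero ∧ allᵇ P (map fsuc (allFin b))      ≡⟨ cong (P fzero ∧_) (allᵇ-map P fsuc (allFin b)) ⟩
  P fzero ∧ allᵇ (P ∘ fsuc) (allFin b)        ∎
  where
  open ≡-Reasoning
  P : Fin (suc b) → Bool
  P y = not (lookup (x ∷ S) y) ∨ g y

⊆ᵇ-full : ∀ {b} (S : Subset b) → S ⊆ᵇ (λ _ → true) ≡ true
⊆ᵇ-full S = allᵇ-true _ (allFin _) (λ y → Boolₚ.∨-zeroʳ (not (lookup S y)))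

∑-kSubsets-⊆ᵇ : ∀ b (g : Fin b → Bool) k →
  ∑[ S ∈ allSubsets b ] ind ((∣ S ∣ ≡ᵇ k) ∧ S ⊆ᵇ g) ≡ (∑[ y ∈ allFin b ] ind (g y)) C k
∑-kSubsets-⊆ᵇ zero    g zero    = refl
∑-kSubsets-⊆ᵇ zero    g (suc k) = refl
∑-kSubsets-⊆ᵇ (suc b) g k = begin
  ∑ (map (true ∷_) Ss ++ map (false ∷_) Ss) F
    ≡⟨ ∑-++ (map (true ∷_) Ss) _ F ⟩
  ∑ (map (true ∷_) Ss) F + ∑ (map (false ∷_) Ss) F
    ≡⟨ cong₂ _+_ (∑-map (true ∷_) Ss F) (∑-map (false ∷_) Ss F) ⟩
  ∑[ S ∈ Ss ] F (true ∷ S) + ∑[ S ∈ Ss ] F (false ∷ S)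
    ≡⟨ cong₂ _+_ (∑-cong Ss (λ S → cong (λ u → ind ((suc ∣ S ∣ ≡ᵇ k) ∧ u)) (∷-⊆ᵇ true S g)))
                 (∑-cong Ss (λ S → cong (λ u → ind ((∣ S ∣ ≡ᵇ k) ∧ u)) (∷-⊆ᵇ false S g))) ⟩
  ∑[ S ∈ Ss ] ind ((suc ∣ S ∣ ≡ᵇ k) ∧ (g fzero ∧ S ⊆ᵇ g′)) + #⊆ g′ k
    ≡⟨ pascal k (g fzero) ⟩
  (ind (g fzero) + ∑[ y ∈ allFin b ] ind (g′ y)) C k
    ≡⟨ cong (_C k) (∑-allFin-suc b (ind ∘ g)) ⟨
  (∑[ y ∈ allFin (suc b) ] ind (g y)) C k ∎
  where
  open ≡-Reasoning
  Ss : List (Subset b)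
  Ss = allSubsets b
  F : Subset (suc b) → ℕ
  F S = ind ((∣ S ∣ ≡ᵇ k) ∧ S ⊆ᵇ g)
  g′ : Fin b → Bool
  g′ = g ∘ fsuc
  #⊆ : (Fin b → Bool) → ℕ → ℕ
  #⊆ h k = ∑[ S ∈ Ss ] ind ((∣ S ∣ ≡ᵇ k) ∧ S ⊆ᵇ h)
  pascal : ∀ k γ →
    ∑[ S ∈ Ss ] ind ((suc ∣ S ∣ ≡ᵇ k) ∧ (γ ∧ S ⊆ᵇ g′)) + #⊆ g′ k
      ≡ (ind γ + ∑[ y ∈ allFin b ] ind (g′ y)) C k
  pascal zero    γ     = trans (cong (_+ #⊆ g′ zero) (∑-zero Ss)) (∑-kSubsets-⊆ᵇ b g′ zero)
  pascal (suc k) true  = trans (cong₂ _+_ (∑-kSubsets-⊆ᵇ b g′ k) (∑-kSubsets-⊆ᵇ b g′ (suc k)))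
                               (nCk+nC[k+1]≡[n+1]C[k+1] _ k)
  pascal (suc k) false = trans (cong (_+ #⊆ g′ (suc k)) none) (∑-kSubsets-⊆ᵇ b g′ (suc k))
    where
    none : ∑[ S ∈ Ss ] ind ((∣ S ∣ ≡ᵇ k) ∧ false) ≡ 0
    none = trans (∑-cong Ss (λ S → cong ind (Boolₚ.∧-zeroʳ _))) (∑-zero Ss)

∑-kSubsets : ∀ b k → ∑[ S ∈ allSubsets b ] ind (∣ S ∣ ≡ᵇ k) ≡ b C k
∑-kSubsets b k = begin
  ∑[ S ∈ allSubsets b ] ind (∣ S ∣ ≡ᵇ k)
    ≡⟨ ∑-cong (allSubsets b) (λ S → cong ind (Boolₚ.∧-identityʳ (∣ S ∣ ≡ᵇ k))) ⟨
  ∑[ S ∈ allSubsets b ] ind ((∣ S ∣ ≡ᵇ k) ∧ true)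
    ≡⟨ ∑-cong (allSubsets b) (λ S → cong (λ u → ind ((∣ S ∣ ≡ᵇ k) ∧ u)) (⊆ᵇ-full S)) ⟨
  ∑[ S ∈ allSubsets b ] ind ((∣ S ∣ ≡ᵇ k) ∧ S ⊆ᵇ (λ _ → true))
    ≡⟨ ∑-kSubsets-⊆ᵇ b (λ _ → true) k ⟩
  (∑[ y ∈ allFin b ] 1) C k
    ≡⟨ cong (_C k) (trans (∑-const (allFin b) 1) (trans (ℕₚ.*-identityʳ _) (length-allFin b))) ⟩
  b C k ∎
  where open ≡-Reasoning

-- Binomial coefficients

nCk≤[1+n]Ck : ∀ n k → n C k ≤ suc n C k
nCk≤[1+n]Ck n zero    = ℕₚ.≤-refl
nCk≤[1+n]Ck n (suc k) = subst (n C suc k ≤_) (nCk+nC[k+1]≡[n+1]C[k+1] n k) (ℕₚ.m≤n+m _ _)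

C-monoˡ-≤ : ∀ {m n} k → m ≤ n → m C k ≤ n C k
C-monoˡ-≤ {m} k m≤n = go (ℕₚ.≤⇒≤′ m≤n)
  where
  go : ∀ {n} → m ≤′ n → m C k ≤ n C k
  go ≤′-refl      = ℕₚ.≤-refl
  go (≤′-step m≤n) = ℕₚ.≤-trans (go m≤n) (nCk≤[1+n]Ck _ k)

mC[1+k]+j*mCk≤[j+m]C[1+k] : ∀ j m k → m C suc k + j * (m C k) ≤ (j + m) C suc k
mC[1+k]+j*mCk≤[j+m]C[1+k] zero    m k = ℕₚ.≤-reflexive (ℕₚ.+-identityʳ _)
mC[1+k]+j*mCk≤[j+m]C[1+k] (suc j) m k = begin
  m C suc k + (m C k + j * (m C k))  ≡⟨ x∙yz≈y∙xz (m C suc k) (m C k) _ ⟩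
  m C k + (m C suc k + j * (m C k))  ≤⟨ ℕₚ.+-mono-≤ (C-monoˡ-≤ k (ℕₚ.m≤n+m m j))
                                                      (mC[1+k]+j*mCk≤[j+m]C[1+k] j m k) ⟩
  (j + m) C k + (j + m) C suc k      ≡⟨ nCk+nC[k+1]≡[n+1]C[k+1] (j + m) k ⟩
  (suc j + m) C suc k                ∎
  where open ℕₚ.≤-Reasoning

[j+y]C[1+k]≤yC[1+k]+j*MCk : ∀ j y M k → j + y ≤ M → (j + y) C suc k ≤ y C suc k + j * (M C k)
[j+y]C[1+k]≤yC[1+k]+j*MCk zero    y M k _ = ℕₚ.m≤m+n _ _
[j+y]C[1+k]≤yC[1+k]+j*MCk (suc j) y M k 1+j+y≤M = begin
  (suc j + y) C suc k                ≡⟨ nCk+nC[k+1]≡[n+1]C[k+1] (j + y) k ⟨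
  (j + y) C k + (j + y) C suc k      ≤⟨ ℕₚ.+-mono-≤ (C-monoˡ-≤ k j+y≤M)
                                                      ([j+y]C[1+k]≤yC[1+k]+j*MCk j y M k j+y≤M) ⟩
  M C k + (y C suc k + j * (M C k))  ≡⟨ x∙yz≈y∙xz (M C k) (y C suc k) _ ⟩
  y C suc k + (M C k + j * (M C k))  ∎
  where
  open ℕₚ.≤-Reasoning
  j+y≤M : j + y ≤ M
  j+y≤M = ℕₚ.≤-trans (ℕₚ.n≤1+n _) 1+j+y≤M

-- Convexity of y ↦ y C (1 + k): its graph lies above its tangent line at m, of slope m C k.
mC[1+k]+y*mCk≤yC[1+k]+m*mCk : ∀ y m k → m C suc k + y * (m C k) ≤ y C suc k + m * (m C k)
mC[1+k]+y*mCk≤yC[1+k]+m*mCk y m k = [ m≤y , y≤m ]′ (ℕₚ.≤-total m y)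
  where
  open ℕₚ.≤-Reasoning
  m≤y : m ≤ y → m C suc k + y * (m C k) ≤ y C suc k + m * (m C k)
  m≤y m≤y = subst (λ y → m C suc k + y * D ≤ y C suc k + m * D) (ℕₚ.m∸n+n≡m m≤y) (begin
    m C suc k + (j + m) * D      ≡⟨ cong (m C suc k +_) (ℕₚ.*-distribʳ-+ D j m) ⟩
    m C suc k + (j * D + m * D)  ≡⟨ ℕₚ.+-assoc (m C suc k) _ _ ⟨
    m C suc k + j * D + m * D    ≤⟨ ℕₚ.+-monoˡ-≤ (m * D) (mC[1+k]+j*mCk≤[j+m]C[1+k] j m k) ⟩
    (j + m) C suc k + m * D      ∎)
    where
    j D : ℕ
    j = y ∸ m
    D = m C k
  y≤m : y ≤ m → m C suc k + y * (m C k) ≤ y C suc k + m * (m C k)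
  y≤m y≤m = subst (λ m → m C suc k + y * (m C k) ≤ y C suc k + m * (m C k)) (ℕₚ.m∸n+n≡m y≤m) (begin
    (j + y) C suc k + y * D      ≤⟨ ℕₚ.+-monoˡ-≤ (y * D) ([j+y]C[1+k]≤yC[1+k]+j*MCk j y (j + y) k ℕₚ.≤-refl) ⟩
    y C suc k + j * D + y * D    ≡⟨ ℕₚ.+-assoc (y C suc k) _ _ ⟩
    y C suc k + (j * D + y * D)  ≡⟨ cong (y C suc k +_) (ℕₚ.*-distribʳ-+ D j y) ⟨
    y C suc k + (j + y) * D      ∎)
    where
    j D : ℕ
    j = m ∸ y
    D = (j + y) C k

[1+k]*nC[1+k]≡[n∸k]*nCk : ∀ n k → suc k * (n C suc k) ≡ (n ∸ k) * (n C k)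
[1+k]*nC[1+k]≡[n∸k]*nCk zero    k rewrite ℕₚ.0∸n≡0 k = ℕₚ.*-zeroʳ (suc k)
[1+k]*nC[1+k]≡[n∸k]*nCk (suc n) zero    =
  trans (ℕₚ.*-identityˡ _) (trans (nC1≡n (suc n)) (sym (ℕₚ.*-identityʳ (suc n))))
[1+k]*nC[1+k]≡[n∸k]*nCk (suc n) (suc k) = begin
  (2 + k) * (suc n C (2 + k))             ≡⟨ cong ((2 + k) *_) (nCk+nC[k+1]≡[n+1]C[k+1] n (suc k)) ⟨
  (2 + k) * (B + n C (2 + k))             ≡⟨ ℕₚ.*-distribˡ-+ (2 + k) B _ ⟩
  (2 + k) * B + (2 + k) * (n C (2 + k))   ≡⟨ cong ((2 + k) * B +_) ([1+k]*nC[1+k]≡[n∸k]*nCk n (suc k)) ⟩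
  (2 + k) * B + (n ∸ suc k) * B           ≡⟨ shift ⟩
  suc k * B + (n ∸ k) * B                 ≡⟨ cong (_+ (n ∸ k) * B) ([1+k]*nC[1+k]≡[n∸k]*nCk n k) ⟩
  (n ∸ k) * (n C k) + (n ∸ k) * B         ≡⟨ ℕₚ.*-distribˡ-+ (n ∸ k) (n C k) B ⟨
  (n ∸ k) * (n C k + B)                   ≡⟨ cong ((n ∸ k) *_) (nCk+nC[k+1]≡[n+1]C[k+1] n k) ⟩
  (n ∸ k) * (suc n C suc k)               ∎
  where
  open ≡-Reasoning
  B : ℕ
  B = n C suc k
  -- n ∸ k = 1 + (n ∸ suc k) holds only when k < n; otherwise B = 0.
  shift : (2 + k) * B + (n ∸ suc k) * B ≡ suc k * B + (n ∸ k) * B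
  shift = [ k<n , n≤k ]′ (ℕₚ.<-≤-connex k n)
    where
    k<n : k ℕ.< n → (2 + k) * B + (n ∸ suc k) * B ≡ suc k * B + (n ∸ k) * B
    k<n k<n = trans (ring k (n ∸ suc k) B) (cong (λ i → suc k * B + i * B) (sym (ℕₚ.+-∸-assoc 1 k<n)))
      where
      ring : ∀ k t x → (2 + k) * x + t * x ≡ suc k * x + suc t * x
      ring = solve-∀
    n≤k : n ≤ k → (2 + k) * B + (n ∸ suc k) * B ≡ suc k * B + (n ∸ k) * B
    n≤k n≤k = subst (λ x → (2 + k) * x + (n ∸ suc k) * x ≡ suc k * x + (n ∸ k) * x)
      (sym (k>n⇒nCk≡0 (s≤s n≤k)))
      (trans (cong₂ _+_ (ℕₚ.*-zeroʳ (2 + k)) (ℕₚ.*-zeroʳ (n ∸ suc k)))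
             (sym (cong₂ _+_ (ℕₚ.*-zeroʳ (suc k)) (ℕₚ.*-zeroʳ (n ∸ k)))))

∑-C-jensen : ∀ (xs : List X) (f : X → ℕ) m k → m * length xs ≤ ∑ xs f →
             length xs * (m C suc k) ≤ ∑[ x ∈ xs ] (f x C suc k)
∑-C-jensen xs f m k m*len≤∑f = ℕₚ.+-cancelʳ-≤ (len * (m * D)) _ _ (begin
  len * (m C suc k) + len * (m * D)            ≤⟨ ℕₚ.+-monoʳ-≤ _ len*m*D≤∑f*D ⟩
  len * (m C suc k) + ∑ xs f * D               ≡⟨ cong₂ _+_ (∑-const xs _) (∑-*ʳ D xs f) ⟨
  ∑[ x ∈ xs ] (m C suc k) + ∑[ x ∈ xs ] (f x * D)   ≡⟨ ∑-+ xs _ _ ⟨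
  ∑[ x ∈ xs ] (m C suc k + f x * D)            ≤⟨ ∑-mono-≤ xs (λ x → mC[1+k]+y*mCk≤yC[1+k]+m*mCk (f x) m k) ⟩
  ∑[ x ∈ xs ] (f x C suc k + m * D)            ≡⟨ ∑-+ xs _ _ ⟩
  ∑[ x ∈ xs ] (f x C suc k) + ∑[ x ∈ xs ] (m * D)   ≡⟨ cong (∑[ x ∈ xs ] (f x C suc k) +_) (∑-const xs _) ⟩
  ∑[ x ∈ xs ] (f x C suc k) + len * (m * D)    ∎)
  where
  open ℕₚ.≤-Reasoning
  len D : ℕ
  len = length xs
  D = m C k
  len*m*D≤∑f*D : len * (m * D) ≤ ∑ xs f * D
  len*m*D≤∑f*D = subst (_≤ ∑ xs f * D) (trans (cong (_* D) (ℕₚ.*-comm m len)) (ℕₚ.*-assoc len m D))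
                       (ℕₚ.*-monoˡ-≤ D m*len≤∑f)

-- Rationals

ℕ→ℚ≡mkℚ : ∀ n → ℕ→ℚ n ≡ mkℚ (ℤ.+ n) 0 (Coprime.sym (Coprime.1-coprimeTo n))
ℕ→ℚ≡mkℚ n = ℚₚ.normalize-coprime (Coprime.sym (Coprime.1-coprimeTo n))

ℕ→ℚ-homo-+ : ∀ m n → ℕ→ℚ (m + n) ≡ ℕ→ℚ m +ℚ ℕ→ℚ n
ℕ→ℚ-homo-+ m n rewrite ℕ→ℚ≡mkℚ m | ℕ→ℚ≡mkℚ n =
  cong (ℚ._/ 1) (sym (cong₂ ℤ._+_ (ℤₚ.*-identityʳ (ℤ.+ m)) (ℤₚ.*-identityʳ (ℤ.+ n))))

ℕ→ℚ-homo-* : ∀ m n → ℕ→ℚ (m * n) ≡ ℕ→ℚ m *ℚ ℕ→ℚ n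
ℕ→ℚ-homo-* m n rewrite ℕ→ℚ≡mkℚ m | ℕ→ℚ≡mkℚ n = cong (ℚ._/ 1) (ℤₚ.pos-* m n)

ℕ→ℚ-mono-≤ : ∀ {m n} → m ≤ n → ℕ→ℚ m ≤ℚ ℕ→ℚ n
ℕ→ℚ-mono-≤ {m} {n} m≤n rewrite ℕ→ℚ≡mkℚ m | ℕ→ℚ≡mkℚ n =
  *≤* (subst₂ ℤ._≤_ (sym (ℤₚ.*-identityʳ (ℤ.+ m))) (sym (ℤₚ.*-identityʳ (ℤ.+ n))) (ℤ.+≤+ m≤n))

ℕ→ℚ-mono-< : ∀ {m n} → m ℕ.< n → ℕ→ℚ m < ℕ→ℚ n
ℕ→ℚ-mono-< {m} {n} m<n rewrite ℕ→ℚ≡mkℚ m | ℕ→ℚ≡mkℚ n =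
  *<* (subst₂ ℤ._<_ (sym (ℤₚ.*-identityʳ (ℤ.+ m))) (sym (ℤₚ.*-identityʳ (ℤ.+ n))) (ℤ.+<+ m<n))

ℕ→ℚ-cancel-≤ : ∀ {m n} → ℕ→ℚ m ≤ℚ ℕ→ℚ n → m ≤ n
ℕ→ℚ-cancel-≤ {m} {n} m≤n rewrite ℕ→ℚ≡mkℚ m | ℕ→ℚ≡mkℚ n with m≤n
... | *≤* m≤n = ℤₚ.drop‿+≤+ (subst₂ ℤ._≤_ (ℤₚ.*-identityʳ (ℤ.+ m)) (ℤₚ.*-identityʳ (ℤ.+ n)) m≤n)

0≤ℕ→ℚ : ∀ n → 0ℚ ≤ℚ ℕ→ℚ n
0≤ℕ→ℚ n = ℕ→ℚ-mono-≤ {0} {n} z≤n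

*-nonNeg : 0ℚ ≤ℚ p → 0ℚ ≤ℚ q → 0ℚ ≤ℚ p *ℚ q
*-nonNeg {p} {q} 0≤p 0≤q =
  ℚₚ.nonNegative⁻¹ _ {{ℚₚ.nonNeg*nonNeg⇒nonNeg p {{nonNegative 0≤p}} q {{nonNegative 0≤q}}}}

*-monoˡ-≤ : 0ℚ ≤ℚ r → p ≤ℚ q → r *ℚ p ≤ℚ r *ℚ q
*-monoˡ-≤ {r} 0≤r = ℚₚ.*-monoˡ-≤-nonNeg r {{nonNegative 0≤r}}

*-monoʳ-≤ : 0ℚ ≤ℚ r → p ≤ℚ q → p *ℚ r ≤ℚ q *ℚ r
*-monoʳ-≤ {r} 0≤r = ℚₚ.*-monoʳ-≤-nonNeg r {{nonNegative 0≤r}}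

*-mono-≤ : 0ℚ ≤ℚ q → 0ℚ ≤ℚ r → p ≤ℚ q → r ≤ℚ s → p *ℚ r ≤ℚ q *ℚ s
*-mono-≤ 0≤q 0≤r p≤q r≤s = ℚₚ.≤-trans (*-monoʳ-≤ 0≤r p≤q) (*-monoˡ-≤ 0≤q r≤s)

+-cancelʳ-≤ : ∀ r → p +ℚ r ≤ℚ q +ℚ r → p ≤ℚ q
+-cancelʳ-≤ {p} {q} r p+r≤q+r = subst₂ _≤ℚ_ (cancel p) (cancel q) (ℚₚ.+-monoˡ-≤ (ℚ.- r) p+r≤q+r)
  where
  open +-*-Solver
  cancel : ∀ x → x +ℚ r +ℚ ℚ.- r ≡ x
  cancel x = solve 2 (λ x r → x :+ r :+ (:- r) := x) refl x r

^-nonNeg : ∀ k → 0ℚ ≤ℚ p → 0ℚ ≤ℚ p ^ℚ k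
^-nonNeg zero    0≤p = ℚₚ.<⇒≤ (ℚₚ.positive⁻¹ 1ℚ)
^-nonNeg (suc k) 0≤p = *-nonNeg 0≤p (^-nonNeg k 0≤p)

^-monoˡ-≤ : ∀ k → 0ℚ ≤ℚ p → p ≤ℚ q → p ^ℚ k ≤ℚ q ^ℚ k
^-monoˡ-≤ zero    0≤p p≤q = ℚₚ.≤-refl
^-monoˡ-≤ (suc k) 0≤p p≤q = *-mono-≤ (ℚₚ.≤-trans 0≤p p≤q) (^-nonNeg k 0≤p) p≤q (^-monoˡ-≤ k 0≤p p≤q)

^-≤-1 : ∀ k → 0ℚ ≤ℚ p → p ≤ℚ 1ℚ → p ^ℚ k ≤ℚ 1ℚ
^-≤-1 zero    0≤p p≤1 = ℚₚ.≤-refl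
^-≤-1 (suc k) 0≤p p≤1 = *-mono-≤ (ℚₚ.<⇒≤ (ℚₚ.positive⁻¹ 1ℚ)) (^-nonNeg k 0≤p) p≤1 (^-≤-1 k 0≤p p≤1)

ℕ→ℚ-∑-≤ : ∀ (xs : List X) (f g h : X → ℕ) t →
  (∀ x → ℕ→ℚ (f x) ≤ℚ ℕ→ℚ (g x) +ℚ ℕ→ℚ (h x) *ℚ t) →
  ℕ→ℚ (∑ xs f) ≤ℚ ℕ→ℚ (∑ xs g) +ℚ ℕ→ℚ (∑ xs h) *ℚ t
ℕ→ℚ-∑-≤ []       f g h t f≤g+ht = ℚₚ.≤-reflexive (sym (trans (ℚₚ.+-identityˡ _) (ℚₚ.*-zeroˡ t)))
ℕ→ℚ-∑-≤ (x ∷ xs) f g h t f≤g+ht = begin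
  ℕ→ℚ (f x + ∑ xs f)
    ≡⟨ ℕ→ℚ-homo-+ (f x) _ ⟩
  ℕ→ℚ (f x) +ℚ ℕ→ℚ (∑ xs f)
    ≤⟨ ℚₚ.+-mono-≤ (f≤g+ht x) (ℕ→ℚ-∑-≤ xs f g h t f≤g+ht) ⟩
  (G +ℚ H *ℚ t) +ℚ (Gs +ℚ Hs *ℚ t)
    ≡⟨ solve 5 (λ g h g′ h′ t → (g :+ h :* t) :+ (g′ :+ h′ :* t) := (g :+ g′) :+ (h :+ h′) :* t)
               refl G H Gs Hs t ⟩
  (G +ℚ Gs) +ℚ (H +ℚ Hs) *ℚ t
    ≡⟨ cong₂ (λ u v → u +ℚ v *ℚ t) (ℕ→ℚ-homo-+ (g x) _) (ℕ→ℚ-homo-+ (h x) _) ⟨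
  ℕ→ℚ (g x + ∑ xs g) +ℚ ℕ→ℚ (h x + ∑ xs h) *ℚ t ∎
  where
  open ℚₚ.≤-Reasoning
  open +-*-Solver
  G H Gs Hs : ℚ
  G = ℕ→ℚ (g x)
  H = ℕ→ℚ (h x)
  Gs = ℕ→ℚ (∑ xs g)
  Hs = ℕ→ℚ (∑ xs h)

c^k*bCk≤mCk : ∀ {c} b m k → 0ℚ ≤ℚ c → (∀ {j} → j ℕ.< k → c *ℚ ℕ→ℚ (b ∸ j) ≤ℚ ℕ→ℚ (m ∸ j)) →
        c ^ℚ k *ℚ ℕ→ℚ (b C k) ≤ℚ ℕ→ℚ (m C k)
c^k*bCk≤mCk b m zero    0≤c ratio = ℚₚ.≤-reflexive (ℚₚ.*-identityˡ _)
c^k*bCk≤mCk {c} b m (suc k) 0≤c ratio =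
  ℚₚ.*-cancelˡ-≤-pos K {{positive (ℕ→ℚ-mono-< {0} {suc k} (s≤s z≤n))}} (begin
    K *ℚ (c *ℚ P *ℚ ℕ→ℚ (b C suc k))
      ≡⟨ solve 4 (λ K c P B → K :* (c :* P :* B) := c :* P :* (K :* B)) refl K c P (ℕ→ℚ (b C suc k)) ⟩
    c *ℚ P *ℚ (K *ℚ ℕ→ℚ (b C suc k))
      ≡⟨ cong (c *ℚ P *ℚ_) (absorb b) ⟩
    c *ℚ P *ℚ (ℕ→ℚ (b ∸ k) *ℚ ℕ→ℚ (b C k))
      ≡⟨ solve 4 (λ c P x y → c :* P :* (x :* y) := (c :* x) :* (P :* y))
                 refl c P (ℕ→ℚ (b ∸ k)) (ℕ→ℚ (b C k)) ⟩
    (c *ℚ ℕ→ℚ (b ∸ k)) *ℚ (P *ℚ ℕ→ℚ (b C k))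
      ≤⟨ *-mono-≤ (0≤ℕ→ℚ (m ∸ k)) (*-nonNeg (^-nonNeg k 0≤c) (0≤ℕ→ℚ (b C k)))
                  (ratio (ℕₚ.n<1+n k)) (c^k*bCk≤mCk b m k 0≤c (ratio ∘ ℕₚ.m<n⇒m<1+n)) ⟩
    ℕ→ℚ (m ∸ k) *ℚ ℕ→ℚ (m C k)
      ≡⟨ absorb m ⟨
    K *ℚ ℕ→ℚ (m C suc k) ∎)
  where
  open ℚₚ.≤-Reasoning
  open +-*-Solver
  K P : ℚ
  K = ℕ→ℚ (suc k)
  P = c ^ℚ k
  absorb : ∀ n → K *ℚ ℕ→ℚ (n C suc k) ≡ ℕ→ℚ (n ∸ k) *ℚ ℕ→ℚ (n C k)
  absorb n = begin-equality
    K *ℚ ℕ→ℚ (n C suc k)           ≡⟨ ℕ→ℚ-homo-* (suc k) (n C suc k) ⟨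
    ℕ→ℚ (suc k * (n C suc k))      ≡⟨ cong ℕ→ℚ ([1+k]*nC[1+k]≡[n∸k]*nCk n k) ⟩
    ℕ→ℚ ((n ∸ k) * (n C k))        ≡⟨ ℕ→ℚ-homo-* (n ∸ k) (n C k) ⟩
    ℕ→ℚ (n ∸ k) *ℚ ℕ→ℚ (n C k)     ∎

c*[b∸j]≤m∸j : ∀ {c} b m k → 0ℚ ≤ℚ c → c *ℚ ℕ→ℚ b +ℚ ℕ→ℚ k ≤ℚ ℕ→ℚ (suc m) →
            ∀ {j} → j ℕ.< k → c *ℚ ℕ→ℚ (b ∸ j) ≤ℚ ℕ→ℚ (m ∸ j)
c*[b∸j]≤m∸j {c} b m k 0≤c cb+k≤1+m {j} j<k = +-cancelʳ-≤ (ℕ→ℚ k) (begin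
  c *ℚ ℕ→ℚ (b ∸ j) +ℚ ℕ→ℚ k  ≤⟨ ℚₚ.+-monoˡ-≤ (ℕ→ℚ k) (*-monoˡ-≤ 0≤c (ℕ→ℚ-mono-≤ (ℕₚ.m∸n≤m b j))) ⟩
  c *ℚ ℕ→ℚ b +ℚ ℕ→ℚ k        ≤⟨ cb+k≤1+m ⟩
  ℕ→ℚ (suc m)                ≤⟨ ℕ→ℚ-mono-≤ 1+m≤m∸j+k ⟩
  ℕ→ℚ (m ∸ j + k)            ≡⟨ ℕ→ℚ-homo-+ (m ∸ j) k ⟩
  ℕ→ℚ (m ∸ j) +ℚ ℕ→ℚ k       ∎)
  where
  open ℚₚ.≤-Reasoning
  k≤1+m : k ≤ suc m
  k≤1+m = ℕ→ℚ-cancel-≤ (begin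
    ℕ→ℚ k                      ≡⟨ ℚₚ.+-identityˡ (ℕ→ℚ k) ⟨
    0ℚ +ℚ ℕ→ℚ k                ≤⟨ ℚₚ.+-monoˡ-≤ (ℕ→ℚ k) (*-nonNeg 0≤c (0≤ℕ→ℚ b)) ⟩
    c *ℚ ℕ→ℚ b +ℚ ℕ→ℚ k        ≤⟨ cb+k≤1+m ⟩
    ℕ→ℚ (suc m)                ∎)
  j≤m : j ≤ m
  j≤m = ℕₚ.≤-pred (ℕₚ.≤-trans j<k k≤1+m)
  1+m≤m∸j+k : suc m ≤ m ∸ j + k
  1+m≤m∸j+k = subst (_≤ m ∸ j + k) (trans (ℕₚ.+-suc (m ∸ j) j) (cong suc (ℕₚ.m∸n+n≡m j≤m)))
                    (ℕₚ.+-monoʳ-≤ (m ∸ j) j<k)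

≤⇒≤ᵇ≡true : p ≤ℚ q → (p ≤ᵇ q) ≡ true
≤⇒≤ᵇ≡true = Equivalence.to Boolₚ.T-≡ ∘ ℚₚ.≤⇒≤ᵇ

≤ᵇ≡false⇒> : (p ≤ᵇ q) ≡ false → q < p
≤ᵇ≡false⇒> p≰ᵇq = ℚₚ.≰⇒> (λ p≤q → subst T p≰ᵇq (ℚₚ.≤⇒≤ᵇ p≤q))

-- d ÷ 4 is d *ℚ 1/ 4, and 1/ 4 *ℚ 4 computes to 1ℚ.
2*[2*[d÷4]]≡d : ∀ d → ℕ→ℚ 2 *ℚ (ℕ→ℚ 2 *ℚ (d ÷ ℕ→ℚ 4)) ≡ d
2*[2*[d÷4]]≡d d =
  trans (solve 1 (λ e → con (ℕ→ℚ 2) :* (con (ℕ→ℚ 2) :* e) := e :* con (ℕ→ℚ 4)) refl (d ÷ ℕ→ℚ 4))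
        (trans (ℚₚ.*-assoc d _ _) (ℚₚ.*-identityʳ d))
  where open +-*-Solver

x≤2x : ∀ {x} → 0ℚ ≤ℚ x → x ≤ℚ ℕ→ℚ 2 *ℚ x
x≤2x {x} 0≤x = begin
  x            ≡⟨ ℚₚ.+-identityˡ x ⟨
  0ℚ +ℚ x      ≤⟨ ℚₚ.+-monoˡ-≤ x 0≤x ⟩
  x +ℚ x       ≡⟨ solve 1 (λ x → x :+ x := con (ℕ→ℚ 2) :* x) refl x ⟩
  ℕ→ℚ 2 *ℚ x   ∎
  where
  open ℚₚ.≤-Reasoning
  open +-*-Solver

4*x^[2+k]≤[2*x]^[2+k] : ∀ k {x} → 0ℚ ≤ℚ x → ℕ→ℚ 4 *ℚ x ^ℚ (2 + k) ≤ℚ (ℕ→ℚ 2 *ℚ x) ^ℚ (2 + k)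
4*x^[2+k]≤[2*x]^[2+k] k {x} 0≤x = begin
  ℕ→ℚ 4 *ℚ (x *ℚ (x *ℚ x ^ℚ k))
    ≡⟨ solve 2 (λ x z → con (ℕ→ℚ 4) :* (x :* (x :* z)) := (con (ℕ→ℚ 2) :* x) :* ((con (ℕ→ℚ 2) :* x) :* z))
               refl x (x ^ℚ k) ⟩
  y *ℚ (y *ℚ x ^ℚ k)
    ≤⟨ *-monoˡ-≤ 0≤y (*-monoˡ-≤ 0≤y (^-monoˡ-≤ k 0≤x (x≤2x 0≤x))) ⟩
  y *ℚ (y *ℚ y ^ℚ k)               ∎
  where
  open ℚₚ.≤-Reasoning
  open +-*-Solver
  y : ℚ
  y = ℕ→ℚ 2 *ℚ x
  0≤y : 0ℚ ≤ℚ y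
  0≤y = *-nonNeg (0≤ℕ→ℚ 2) 0≤x

x*n≤m⇒x≤1+m/n : ∀ {x} m n → x *ℚ ℕ→ℚ (suc n) ≤ℚ ℕ→ℚ m → x ≤ℚ ℕ→ℚ (suc (m / suc n))
x*n≤m⇒x≤1+m/n {x} m n x*n≤m =
  ℚₚ.<⇒≤ (ℚₚ.*-cancelʳ-<-nonNeg (ℕ→ℚ (suc n)) {{nonNegative (0≤ℕ→ℚ (suc n))}} (begin-strict
  x *ℚ ℕ→ℚ (suc n)                     ≤⟨ x*n≤m ⟩
  ℕ→ℚ m                                <⟨ ℕ→ℚ-mono-< m<[1+m/n]*n ⟩
  ℕ→ℚ (suc (m / suc n) * suc n)        ≡⟨ ℕ→ℚ-homo-* (suc (m / suc n)) (suc n) ⟩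
  ℕ→ℚ (suc (m / suc n)) *ℚ ℕ→ℚ (suc n) ∎))
  where
  open ℚₚ.≤-Reasoning
  m<[1+m/n]*n : m ℕ.< suc (m / suc n) * suc n
  m<[1+m/n]*n = subst (ℕ._< suc (m / suc n) * suc n) (sym (m≡m%n+[m/n]*n m (suc n)))
                      (ℕₚ.+-monoˡ-< ((m / suc n) * suc n) (m%n<n m (suc n)))

-- Common neighbourhoods of k-sets

degree : {a b : ℕ} → BipGraph a b → Fin a → ℕ
degree {b = b} H x = ∑[ y ∈ allFin b ] ind (H x y)

eBip≡∑degree : ∀ {a b} (H : BipGraph a b) → eBip H ≡ ∑[ x ∈ allFin a ] degree H x
eBip≡∑degree {a} {b} H = trans (count≡∑ind _ (cartesianProduct (allFin a) (allFin b)))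
                               (∑-cartesianProduct (allFin a) (allFin b) _)

∑-commonNbrs≡∑-degree-C : ∀ {a b} (H : BipGraph a b) k →
  ∑[ S ∈ allSubsets b ] (ind (∣ S ∣ ≡ᵇ k) * commonNbrs H S) ≡ ∑[ x ∈ allFin a ] (degree H x C k)
∑-commonNbrs≡∑-degree-C {a} {b} H k = begin
  ∑[ S ∈ Ss ] (ind (K S) * commonNbrs H S)
    ≡⟨ ∑-cong Ss (λ S → cong (ind (K S) *_) (count≡∑ind (λ x → S ⊆ᵇ H x) As)) ⟩
  ∑[ S ∈ Ss ] (ind (K S) * ∑[ x ∈ As ] ind (S ⊆ᵇ H x))
    ≡⟨ ∑-cong Ss (λ S → ∑-*ˡ (ind (K S)) As (λ x → ind (S ⊆ᵇ H x))) ⟨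
  ∑[ S ∈ Ss ] ∑[ x ∈ As ] (ind (K S) * ind (S ⊆ᵇ H x))
    ≡⟨ ∑-swap Ss As (λ S x → ind (K S) * ind (S ⊆ᵇ H x)) ⟩
  ∑[ x ∈ As ] ∑[ S ∈ Ss ] (ind (K S) * ind (S ⊆ᵇ H x))
    ≡⟨ ∑-cong As (λ x → ∑-cong Ss (λ S → ind-∧ (K S) (S ⊆ᵇ H x))) ⟨
  ∑[ x ∈ As ] ∑[ S ∈ Ss ] ind (K S ∧ S ⊆ᵇ H x)
    ≡⟨ ∑-cong As (λ x → ∑-kSubsets-⊆ᵇ b (H x) k) ⟩
  ∑[ x ∈ As ] (degree H x C k) ∎
  where
  open ≡-Reasoning
  Ss : List (Subset b)
  Ss = allSubsets b
  As : List (Fin a)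
  As = allFin a
  K : Subset b → Bool
  K S = ∣ S ∣ ≡ᵇ k

ind*≤-threshold : ∀ κ γ {c a t} → 0ℚ ≤ℚ t → c ≤ a → (γ ≡ false → ℕ→ℚ c ≤ℚ t) →
  ℕ→ℚ (ind κ * c) ≤ℚ ℕ→ℚ (ind (κ ∧ γ) * a) +ℚ ℕ→ℚ (ind κ) *ℚ t
ind*≤-threshold false γ     {t = t} _ _ _ = ℚₚ.≤-reflexive (sym (trans (ℚₚ.+-identityˡ _) (ℚₚ.*-zeroˡ t)))
ind*≤-threshold true  true  {c} {a} {t} 0≤t c≤a _ = begin
  ℕ→ℚ (1 * c)                  ≤⟨ ℕ→ℚ-mono-≤ (ℕₚ.*-monoʳ-≤ 1 c≤a) ⟩
  ℕ→ℚ (1 * a)                  ≡⟨ ℚₚ.+-identityʳ _ ⟨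
  ℕ→ℚ (1 * a) +ℚ 0ℚ            ≤⟨ ℚₚ.+-monoʳ-≤ (ℕ→ℚ (1 * a)) (subst (0ℚ ≤ℚ_) (sym (ℚₚ.*-identityˡ t)) 0≤t) ⟩
  ℕ→ℚ (1 * a) +ℚ 1ℚ *ℚ t       ∎
  where open ℚₚ.≤-Reasoning
ind*≤-threshold true  false {c} {a} {t} _ _ c≤t = begin
  ℕ→ℚ (1 * c)                  ≡⟨ cong ℕ→ℚ (ℕₚ.*-identityˡ c) ⟩
  ℕ→ℚ c                        ≤⟨ c≤t refl ⟩
  t                            ≡⟨ trans (ℚₚ.+-identityˡ _) (ℚₚ.*-identityˡ t) ⟨
  0ℚ +ℚ 1ℚ *ℚ t                ∎
  where open ℚₚ.≤-Reasoning

ind[κ∧ρ]+ind[η]≤ind[η∧ρ]+ind[κ] : ∀ κ η ρ → (η ≡ true → κ ≡ true) →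
                                   ind (κ ∧ ρ) + ind η ≤ ind (η ∧ ρ) + ind κ
ind[κ∧ρ]+ind[η]≤ind[η∧ρ]+ind[κ] κ     true  ρ     η⇒κ rewrite η⇒κ refl = ℕₚ.≤-refl
ind[κ∧ρ]+ind[η]≤ind[η∧ρ]+ind[κ] true  false true  _   = s≤s z≤n
ind[κ∧ρ]+ind[η]≤ind[η∧ρ]+ind[κ] true  false false _   = z≤n
ind[κ∧ρ]+ind[η]≤ind[η∧ρ]+ind[κ] false false ρ     _   = z≤n

rich : {a b : ℕ} → BipGraph a b → ℚ → Subset b → Bool
rich H t S = t ≤ᵇ ℕ→ℚ (commonNbrs H S)

richKSets : {a b : ℕ} → BipGraph a b → ℕ → ℚ → ℕ
richKSets {b = b} H k t = ∑[ S ∈ allSubsets b ] ind ((∣ S ∣ ≡ᵇ k) ∧ rich H t S)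

commonNbrs≤ : ∀ {a b} (H : BipGraph a b) S → commonNbrs H S ≤ a
commonNbrs≤ {a} H S =
  subst (commonNbrs H S ≤_) (length-allFin a) (Listₚ.length-filter (T? ∘ λ x → S ⊆ᵇ H x) (allFin a))

richKSets-nonPos : ∀ {a b} (H : BipGraph a b) k {t} → t ≤ℚ 0ℚ → richKSets H k t ≡ b C k
richKSets-nonPos {b = b} H k {t} t≤0 = trans (∑-cong (allSubsets b) all-rich) (∑-kSubsets b k)
  where
  all-rich : ∀ S → ind ((∣ S ∣ ≡ᵇ k) ∧ rich H t S) ≡ ind (∣ S ∣ ≡ᵇ k)
  all-rich S = cong ind (trans (cong ((∣ S ∣ ≡ᵇ k) ∧_) (≤⇒≤ᵇ≡true (ℚₚ.≤-trans t≤0 (0≤ℕ→ℚ (commonNbrs H S)))))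
                               (Boolₚ.∧-identityʳ _))

ℕ→ℚ-∑-commonNbrs-≤ : ∀ {a b} (H : BipGraph a b) k {t} → 0ℚ ≤ℚ t →
  ℕ→ℚ (∑[ S ∈ allSubsets b ] (ind (∣ S ∣ ≡ᵇ k) * commonNbrs H S))
    ≤ℚ ℕ→ℚ (richKSets H k t * a) +ℚ ℕ→ℚ (b C k) *ℚ t
ℕ→ℚ-∑-commonNbrs-≤ {a} {b} H k {t} 0≤t =
  subst₂ (λ u v → ℕ→ℚ (∑ Ss weighted) ≤ℚ ℕ→ℚ u +ℚ ℕ→ℚ v *ℚ t) (∑-*ʳ a Ss richK) (∑-kSubsets b k) $
  ℕ→ℚ-∑-≤ Ss weighted (λ S → richK S * a) (ind ∘ K) t
    (λ S → ind*≤-threshold (K S) (rich H t S) 0≤t (commonNbrs≤ H S) (ℚₚ.<⇒≤ ∘ ≤ᵇ≡false⇒>))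
  where
  Ss : List (Subset b)
  Ss = allSubsets b
  K : Subset b → Bool
  K S = ∣ S ∣ ≡ᵇ k
  weighted richK : Subset b → ℕ
  weighted S = ind (K S) * commonNbrs H S
  richK S = ind (K S ∧ rich H t S)

richKSets+eHyp≤goodEdges+C : ∀ {a b k} (H : BipGraph a b) (ℋ : Hypergraph b) t → Uniform k ℋ →
  richKSets H k t + eHyp ℋ ≤ goodEdges H ℋ t + b C k
richKSets+eHyp≤goodEdges+C {b = b} {k} H ℋ t uniform = begin
  richKSets H k t + eHyp ℋ
    ≡⟨ cong (richKSets H k t +_) (count≡∑ind ℋ Ss) ⟩
  ∑[ S ∈ Ss ] ind (K S ∧ R S) + ∑[ S ∈ Ss ] ind (ℋ S)
    ≡⟨ ∑-+ Ss _ _ ⟨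
  ∑[ S ∈ Ss ] (ind (K S ∧ R S) + ind (ℋ S))
    ≤⟨ ∑-mono-≤ Ss (λ S → ind[κ∧ρ]+ind[η]≤ind[η∧ρ]+ind[κ] (K S) (ℋ S) (R S) (edge⇒kSubset S)) ⟩
  ∑[ S ∈ Ss ] (ind (ℋ S ∧ R S) + ind (K S))
    ≡⟨ ∑-+ Ss _ _ ⟩
  ∑[ S ∈ Ss ] ind (ℋ S ∧ R S) + ∑[ S ∈ Ss ] ind (K S)
    ≡⟨ cong₂ _+_ (sym (count≡∑ind (λ S → ℋ S ∧ R S) Ss)) (∑-kSubsets b k) ⟩
  goodEdges H ℋ t + b C k ∎
  where
  open ℕₚ.≤-Reasoning
  Ss : List (Subset b)
  Ss = allSubsets b
  K R : Subset b → Bool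
  K S = ∣ S ∣ ≡ᵇ k
  R = rich H t
  edge⇒kSubset : ∀ S → ℋ S ≡ true → K S ≡ true
  edge⇒kSubset S = Equivalence.to Boolₚ.T-≡ ∘ ℕₚ.≡⇒≡ᵇ _ _ ∘ uniform S

avgDegree-C≤richKSets : ∀ {a b} (H : BipGraph (suc a) b) k {τ} → 0ℚ ≤ℚ τ →
  ℕ→ℚ ((eBip H / suc a) C suc k)
    ≤ℚ ℕ→ℚ (richKSets H (suc k) (τ *ℚ ℕ→ℚ (suc a))) +ℚ τ *ℚ ℕ→ℚ (b C suc k)
avgDegree-C≤richKSets {a} {b} H k {τ} 0≤τ =
  ℚₚ.*-cancelˡ-≤-pos A {{positive (ℕ→ℚ-mono-< {0} {suc a} (s≤s z≤n))}} (begin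
    A *ℚ ℕ→ℚ (m C suc k)
      ≡⟨ ℕ→ℚ-homo-* (suc a) (m C suc k) ⟨
    ℕ→ℚ (suc a * (m C suc k))
      ≤⟨ ℕ→ℚ-mono-≤ jensen ⟩
    ℕ→ℚ (∑[ x ∈ allFin (suc a) ] (degree H x C suc k))
      ≡⟨ cong ℕ→ℚ (∑-commonNbrs≡∑-degree-C H (suc k)) ⟨
    ℕ→ℚ (∑[ S ∈ allSubsets b ] (ind (∣ S ∣ ≡ᵇ suc k) * commonNbrs H S))
      ≤⟨ ℕ→ℚ-∑-commonNbrs-≤ H (suc k) (*-nonNeg 0≤τ (0≤ℕ→ℚ (suc a))) ⟩
    ℕ→ℚ (G * suc a) +ℚ N *ℚ (τ *ℚ A)
      ≡⟨ cong (_+ℚ N *ℚ (τ *ℚ A)) (ℕ→ℚ-homo-* G (suc a)) ⟩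
    ℕ→ℚ G *ℚ A +ℚ N *ℚ (τ *ℚ A)
      ≡⟨ solve 4 (λ G A N τ → G :* A :+ N :* (τ :* A) := A :* (G :+ τ :* N)) refl (ℕ→ℚ G) A N τ ⟩
    A *ℚ (ℕ→ℚ G +ℚ τ *ℚ N) ∎)
  where
  open ℚₚ.≤-Reasoning
  open +-*-Solver
  A N : ℚ
  A = ℕ→ℚ (suc a)
  N = ℕ→ℚ (b C suc k)
  m G : ℕ
  m = eBip H / suc a
  G = richKSets H (suc k) (τ *ℚ A)
  jensen : suc a * (m C suc k) ≤ ∑[ x ∈ allFin (suc a) ] (degree H x C suc k)
  jensen = subst (λ n → n * (m C suc k) ≤ ∑[ x ∈ allFin (suc a) ] (degree H x C suc k))
                 (length-allFin (suc a)) $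
    ∑-C-jensen (allFin (suc a)) (degree H) m k $
    subst₂ (λ n E → m * n ≤ E) (sym (length-allFin (suc a))) (eBip≡∑degree H) (m/n*n≤m (eBip H) (suc a))

richKSets-lowerBound : ∀ k {a b} (H : BipGraph a b) {c τ} → 0ℚ ≤ℚ c → c ≤ℚ 1ℚ → 0ℚ ≤ℚ τ →
  (c *ℚ ℕ→ℚ b +ℚ ℕ→ℚ (suc k)) *ℚ ℕ→ℚ a ≤ℚ ℕ→ℚ (eBip H) →
  c ^ℚ suc k *ℚ ℕ→ℚ (b C suc k) ≤ℚ ℕ→ℚ (richKSets H (suc k) (τ *ℚ ℕ→ℚ a)) +ℚ τ *ℚ ℕ→ℚ (b C suc k)
richKSets-lowerBound k {zero} {b} H {c} {τ} 0≤c c≤1 0≤τ _ = begin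
  c ^ℚ suc k *ℚ N     ≤⟨ *-monoʳ-≤ (0≤ℕ→ℚ (b C suc k)) (^-≤-1 (suc k) 0≤c c≤1) ⟩
  1ℚ *ℚ N             ≡⟨ ℚₚ.*-identityˡ N ⟩
  N                   ≡⟨ cong ℕ→ℚ (richKSets-nonPos H (suc k) (ℚₚ.≤-reflexive (ℚₚ.*-zeroʳ τ))) ⟨
  G                   ≡⟨ ℚₚ.+-identityʳ G ⟨
  G +ℚ 0ℚ             ≤⟨ ℚₚ.+-monoʳ-≤ G (*-nonNeg 0≤τ (0≤ℕ→ℚ (b C suc k))) ⟩
  G +ℚ τ *ℚ N         ∎
  where
  open ℚₚ.≤-Reasoning
  N G : ℚ
  N = ℕ→ℚ (b C suc k)
  G = ℕ→ℚ (richKSets H (suc k) (τ *ℚ 0ℚ))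
richKSets-lowerBound k {suc a} {b} H {c} {τ} 0≤c _ 0≤τ [cb+k]a≤e = begin
  c ^ℚ suc k *ℚ ℕ→ℚ (b C suc k)     ≤⟨ c^k*bCk≤mCk b m (suc k) 0≤c (c*[b∸j]≤m∸j b m (suc k) 0≤c cb+k≤1+m) ⟩
  ℕ→ℚ (m C suc k)                   ≤⟨ avgDegree-C≤richKSets H k 0≤τ ⟩
  ℕ→ℚ (richKSets H (suc k) (τ *ℚ ℕ→ℚ (suc a))) +ℚ τ *ℚ ℕ→ℚ (b C suc k) ∎
  where
  open ℚₚ.≤-Reasoning
  m : ℕ
  m = eBip H / suc a
  cb+k≤1+m : c *ℚ ℕ→ℚ b +ℚ ℕ→ℚ (suc k) ≤ℚ ℕ→ℚ (suc m)
  cb+k≤1+m = x*n≤m⇒x≤1+m/n (eBip H) a [cb+k]a≤e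

[c*b+k]*a≤E : ∀ {c d} k a b E → ℕ→ℚ 2 *ℚ c ≡ d →
  ℕ→ℚ (2 * k) ≤ℚ d *ℚ ℕ→ℚ b → d *ℚ ℕ→ℚ a *ℚ ℕ→ℚ b ≤ℚ ℕ→ℚ E →
  (c *ℚ ℕ→ℚ b +ℚ ℕ→ℚ k) *ℚ ℕ→ℚ a ≤ℚ ℕ→ℚ E
[c*b+k]*a≤E {c} {d} k a b E 2c≡d 2k≤db dab≤E = begin
  (c *ℚ ℕ→ℚ b +ℚ ℕ→ℚ k) *ℚ ℕ→ℚ a   ≤⟨ *-monoʳ-≤ (0≤ℕ→ℚ a) cb+k≤db ⟩
  d *ℚ ℕ→ℚ b *ℚ ℕ→ℚ a               ≡⟨ solve 3 (λ d b a → d :* b :* a := d :* a :* b) refl d (ℕ→ℚ b) (ℕ→ℚ a) ⟩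
  d *ℚ ℕ→ℚ a *ℚ ℕ→ℚ b               ≤⟨ dab≤E ⟩
  ℕ→ℚ E                             ∎
  where
  open ℚₚ.≤-Reasoning
  open +-*-Solver
  cb+k≤db : c *ℚ ℕ→ℚ b +ℚ ℕ→ℚ k ≤ℚ d *ℚ ℕ→ℚ b
  cb+k≤db = ℚₚ.*-cancelˡ-≤-pos (ℕ→ℚ 2) (begin
    ℕ→ℚ 2 *ℚ (c *ℚ ℕ→ℚ b +ℚ ℕ→ℚ k)
      ≡⟨ solve 3 (λ c b k → con (ℕ→ℚ 2) :* (c :* b :+ k) := (con (ℕ→ℚ 2) :* c) :* b :+ con (ℕ→ℚ 2) :* k)
                 refl c (ℕ→ℚ b) (ℕ→ℚ k) ⟩
    (ℕ→ℚ 2 *ℚ c) *ℚ ℕ→ℚ b +ℚ ℕ→ℚ 2 *ℚ ℕ→ℚ k  ≡⟨ cong₂ (λ u v → u *ℚ ℕ→ℚ b +ℚ v) 2c≡d (sym (ℕ→ℚ-homo-* 2 k)) ⟩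
    d *ℚ ℕ→ℚ b +ℚ ℕ→ℚ (2 * k)           ≤⟨ ℚₚ.+-monoʳ-≤ (d *ℚ ℕ→ℚ b) 2k≤db ⟩
    d *ℚ ℕ→ℚ b +ℚ d *ℚ ℕ→ℚ b            ≡⟨ solve 1 (λ x → x :+ x := con (ℕ→ℚ 2) :* x) refl (d *ℚ ℕ→ℚ b) ⟩
    ℕ→ℚ 2 *ℚ (d *ℚ ℕ→ℚ b)               ∎)

goodEdges-bound : ∀ {ζ} G E g N → 0ℚ ≤ℚ ζ →
  ℕ→ℚ 4 *ℚ ζ *ℚ ℕ→ℚ N ≤ℚ ℕ→ℚ G +ℚ ζ *ℚ ℕ→ℚ N → (1ℚ - ζ) *ℚ ℕ→ℚ N ≤ℚ ℕ→ℚ E → G + E ≤ g + N →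
  ζ *ℚ ℕ→ℚ N ≤ℚ ℕ→ℚ g
goodEdges-bound {ζ} G E g N 0≤ζ 4ζN≤G+ζN [1-ζ]N≤E G+E≤g+N = +-cancelʳ-≤ (ℕ→ℚ N +ℚ x) (begin
  x +ℚ (ℕ→ℚ N +ℚ x)                         ≡⟨ ℚₚ.+-identityˡ _ ⟨
  0ℚ +ℚ (x +ℚ (ℕ→ℚ N +ℚ x))                 ≤⟨ ℚₚ.+-monoˡ-≤ _ (*-nonNeg 0≤ζ (0≤ℕ→ℚ N)) ⟩
  x +ℚ (x +ℚ (ℕ→ℚ N +ℚ x))
    ≡⟨ solve 2 (λ z n → z :* n :+ (z :* n :+ (n :+ z :* n)) := con (ℕ→ℚ 4) :* z :* n :+ (con 1ℚ :- z) :* n)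
               refl ζ (ℕ→ℚ N) ⟩
  ℕ→ℚ 4 *ℚ ζ *ℚ ℕ→ℚ N +ℚ (1ℚ - ζ) *ℚ ℕ→ℚ N  ≤⟨ ℚₚ.+-mono-≤ 4ζN≤G+ζN [1-ζ]N≤E ⟩
  ℕ→ℚ G +ℚ x +ℚ ℕ→ℚ E
    ≡⟨ solve 3 (λ G x E → G :+ x :+ E := G :+ E :+ x) refl (ℕ→ℚ G) x (ℕ→ℚ E) ⟩
  ℕ→ℚ G +ℚ ℕ→ℚ E +ℚ x                       ≡⟨ cong (_+ℚ x) (ℕ→ℚ-homo-+ G E) ⟨
  ℕ→ℚ (G + E) +ℚ x                          ≤⟨ ℚₚ.+-monoˡ-≤ x (ℕ→ℚ-mono-≤ G+E≤g+N) ⟩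
  ℕ→ℚ (g + N) +ℚ x                          ≡⟨ cong (_+ℚ x) (ℕ→ℚ-homo-+ g N) ⟩
  ℕ→ℚ g +ℚ ℕ→ℚ N +ℚ x                       ≡⟨ ℚₚ.+-assoc (ℕ→ℚ g) _ _ ⟩
  ℕ→ℚ g +ℚ (ℕ→ℚ N +ℚ x)                     ∎)
  where
  open ℚₚ.≤-Reasoning
  open +-*-Solver
  x : ℚ
  x = ζ *ℚ ℕ→ℚ N

lemma3p3 : (k : ℕ) → 2 ≤ k → (d : ℚ) → 0ℚ < d → d < 1ℚ →
    (a b : ℕ) → (H : BipGraph a b) → (ℋ : Hypergraph b) → Uniform k ℋ →
    ℕ→ℚ (2 * k) ≤ℚ d *ℚ ℕ→ℚ b →
    d *ℚ ℕ→ℚ a *ℚ ℕ→ℚ b ≤ℚ ℕ→ℚ (eBip H) →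
    (1ℚ - (d ÷ ℕ→ℚ 4) ^ℚ k) *ℚ ℕ→ℚ (b C k) ≤ℚ ℕ→ℚ (eHyp ℋ) →
    ((d ÷ ℕ→ℚ 4) ^ℚ k) *ℚ ℕ→ℚ (b C k)
      ≤ℚ ℕ→ℚ (goodEdges H ℋ (((d ÷ ℕ→ℚ 4) ^ℚ k) *ℚ ℕ→ℚ a))
lemma3p3 zero          ()
lemma3p3 (suc zero)    (s≤s ())
lemma3p3 (suc (suc k)) _ d 0<d d<1 a b H ℋ uniform 2k≤db dab≤E almost-complete =
  goodEdges-bound (richKSets H K t) (eHyp ℋ) (goodEdges H ℋ t) (b C K) 0≤ζ
    (ℚₚ.≤-trans (*-monoʳ-≤ (0≤ℕ→ℚ (b C K)) (4*x^[2+k]≤[2*x]^[2+k] k 0≤e))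
                (richKSets-lowerBound (suc k) H 0≤c c≤1 0≤ζ
                  ([c*b+k]*a≤E {c} {d} K a b (eBip H) (2*[2*[d÷4]]≡d d) 2k≤db dab≤E)))
    almost-complete
    (richKSets+eHyp≤goodEdges+C H ℋ t uniform)
  where
  K : ℕ
  K = suc (suc k)
  e ζ t c : ℚ
  e = d ÷ ℕ→ℚ 4
  ζ = e ^ℚ K
  t = ζ *ℚ ℕ→ℚ a
  c = ℕ→ℚ 2 *ℚ e
  0≤e : 0ℚ ≤ℚ e
  0≤e = *-nonNeg (ℚₚ.<⇒≤ 0<d) (ℚₚ.nonNegative⁻¹ _)
  0≤c : 0ℚ ≤ℚ c
  0≤c = *-nonNeg (0≤ℕ→ℚ 2) 0≤e
  0≤ζ : 0ℚ ≤ℚ ζ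
  0≤ζ = ^-nonNeg K 0≤e
  c≤1 : c ≤ℚ 1ℚ
  c≤1 = ℚₚ.≤-trans (subst (c ≤ℚ_) (2*[2*[d÷4]]≡d d) (x≤2x 0≤c)) (ℚₚ.<⇒≤ d<1)
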